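{- Let $q$ be a power of an odd prime, let $\lambda\in\mathbb{F}_q$ be a non-square, and let $f\in\mathbb{F}_q[X]$ be a permutation polynomial of $\mathbb{F}_q$. Then every (weakly) connected component of $\mathcal{G}(\lambda,f)$ has a Hamiltonian cycle, i.e. a directed cycle passing through every vertex of the component exactly once.
   Context: For a polynomial $f\in\mathbb{F}_q[X]$ and a non-square $\lambda\in\mathbb{F}_q$, $\mathcal{G}(\lambda,f)$ is the directed graph whose vertex set is $\mathbb{F}_q$, with an edge from $x$ to $y$ if and only if $(y^2-f(x))(\lambda y^2-f(x))=0$; loops are allowed. -}

module Defs where

open import Level using (Level; suc; _⊔_)
open import Data.Nat using (ℕ)
open import Data.Fin using (Fin)
open import Data.Product using (Σ; ∃; _×_; _,_)
open import Data.Sum using (_⊎_)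
open import Data.List using (List; []; _∷_)
open import Data.List.Membership.Propositional using (_∈_)
open import Data.List.Relation.Unary.Unique.Propositional using (Unique)
open import Relation.Nullary using (¬_)
open import Relation.Binary.PropositionalEquality using (_≡_)
open import Relation.Binary.Construct.Closure.ReflexiveTransitive using (Star)
open import Relation.Binary.Construct.Closure.Symmetric using (SymClosure)
open import Algebra.Structures using (IsCommutativeRing)
open import Function.Bundles using (_↔_)

record FiniteField (c : Level) : Set (suc c) where
  field
    Carrier : Set c
    _+_ _*_ : Carrier → Carrier → Carrier
    -_      : Carrier → Carrier
    0# 1#   : Carrier
    isCommutativeRing : IsCommutativeRing _≡_ _+_ _*_ -_ 0# 1#
    0≢1     : ¬ (0# ≡ 1#)
    inverse : ∀ x → ¬ (x ≡ 0#) → ∃ λ y → x * y ≡ 1#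
    order   : ℕ
    enum    : Carrier ↔ Fin order
  infixl 6 _+_
  infixl 7 _*_

module _ {c : Level} (F : FiniteField c) where
  open FiniteField F

  -- characteristic ≠ 2, i.e. q is a power of an odd prime
  OddCharacteristic : Set c
  OddCharacteristic = ¬ (1# + 1# ≡ 0#)

  IsSquare : Carrier → Set c
  IsSquare a = ∃ λ y → y * y ≡ a

  NonSquare : Carrier → Set c
  NonSquare a = ¬ IsSquare a

  -- polynomials in F[X] as coefficient lists, lowest degree first
  Poly : Set c
  Poly = List Carrier

  eval : Poly → Carrier → Carrier
  eval []       x = 0#
  eval (a ∷ as) x = a + x * eval as x

  IsPermutationPoly : Poly → Set c
  IsPermutationPoly f =
    (∀ x y → eval f x ≡ eval f y → x ≡ y) × (∀ z → ∃ λ x → eval f x ≡ z)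

  Edge : Carrier → Poly → Carrier → Carrier → Set c
  Edge λ' f x y = (y * y + - eval f x) * (λ' * (y * y) + - eval f x) ≡ 0#

  WeaklyConnected : Carrier → Poly → Carrier → Carrier → Set c
  WeaklyConnected λ' f = Star (SymClosure (Edge λ' f))

  -- consecutive vertices of a list v₀ v₁ … v_{k-1} are joined by edges, and
  -- v_{k-1} → v₀ closes the cycle; `first` is v₀
  CycleEdges : Carrier → Poly → Carrier → List Carrier → Set c
  CycleEdges λ' f first []           = Level.Lift c Data.Unit.⊤
    where import Data.Unit
  CycleEdges λ' f first (v ∷ [])     = Edge λ' f v first
  CycleEdges λ' f first (v ∷ w ∷ vs) = Edge λ' f v w × CycleEdges λ' f first (w ∷ vs)

  IsDirectedCycle : Carrier → Poly → List Carrier → Set c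
  IsDirectedCycle λ' f []       = Level.Lift c Data.Empty.⊥
    where import Data.Empty
  IsDirectedCycle λ' f (v ∷ vs) = Unique (v ∷ vs) × CycleEdges λ' f v (v ∷ vs)

  ComponentHasHamiltonianCycle : Carrier → Poly → Carrier → Set c
  ComponentHasHamiltonianCycle λ' f x =
    ∃ λ (cyc : List Carrier) →
      IsDirectedCycle λ' f cyc × (∀ y → (y ∈ cyc → WeaklyConnected λ' f x y) × (WeaklyConnected λ' f x y → y ∈ cyc))

-- As λ is a non-square, squaring
-- one element of each pair {y, −y} and λ-scaling the square of the other is a bijection h of F, so
-- the out-neighbours of x are ±σ(x) for the permutation σ = h⁻¹ ∘ f. The vertex p(x) with
-- σ(p x) = −σ(x) has the same out-neighbours, so the edges out of x are x → π x and x → π (p x) for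
-- π = σ, and this stays true when π(a) and π(p a) are exchanged. Such an exchange splices the
-- π-cycles through a and p a when they differ and never separates two vertices of one cycle; doing
-- it for every a puts each x on the π-cycle of p x. Then every edge stays inside a π-cycle, so the
-- weak components are the π-cycles, and each of them is a Hamiltonian cycle of its component.

module Submission where

open import Defs
open import Level using (Level; _⊔_)
open import Data.Nat as ℕ using (ℕ; zero; suc; _<_; _%_; s≤s)
import Data.Nat.Properties as ℕ
open import Data.Nat.DivMod using (_/_; m≡m%n+[m/n]*n; m%n<n)
open import Data.Nat.Induction using (<-rec)
open import Data.Fin as Fin using (Fin; toℕ)
import Data.Fin.Properties as Fin
open import Data.Product using (∃; _×_; _,_; proj₁; proj₂)
open import Data.Sum using (_⊎_; inj₁; inj₂; swap)
open import Data.List using (List; []; _∷_; applyUpTo; tabulate)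
open import Data.List.Membership.Propositional using (_∈_)
import Data.List.Membership.DecPropositional as DecMembership
open import Data.List.Membership.Propositional.Properties using (∈-applyUpTo⁺; ∈-applyUpTo⁻; ∈-tabulate⁺)
open import Data.List.Relation.Unary.Any using (here; there)
open import Data.List.Relation.Unary.Unique.Propositional using (Unique)
open import Data.List.Relation.Unary.Unique.Propositional.Properties using (applyUpTo⁺₁)
open import Function using (id; _∘_; _↔_; _⇔_; mk⇔; Injective; Inverse; Injection; Equivalence)
open import Function.Construct.Composition using (_⇔-∘_)
open import Function.Construct.Symmetry using (⇔-sym)
open import Function.Properties.Inverse using (↔⇒↣; ↔-sym)
open import Relation.Binary.Construct.Closure.ReflexiveTransitive using (Star; ε; _◅_)
open import Relation.Binary.Construct.Closure.Symmetric using (SymClosure; fwd; bwd)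
open import Relation.Nullary using (¬_; Dec; yes; no; contradiction)
import Relation.Nullary.Decidable as Dec
open import Relation.Unary using (Pred; Decidable)
open import Relation.Binary using (DecidableEquality)
open import Relation.Binary.PropositionalEquality
open import Algebra using (CommutativeRing)
open import Algebra.Structures using (IsCommutativeRing)

private
  variable
    a : Level
    A : Set a
    σ : A → A
    x y z : A
    d i j k n : ℕ

injective⇒surjective : {g : Fin n → Fin n} → Injective _≡_ _≡_ g → ∀ y → ∃ λ x → g x ≡ y
injective⇒surjective {zero} _ ()
injective⇒surjective {suc n} {g} g-inj y with Fin.any? (λ x → g x Fin.≟ y)
... | yes hit = hit
... | no miss = contradiction (Fin.injective⇒≤ punchOut∘g-injective) ℕ.1+n≰n
  where
    y≢g : ∀ x → y ≢ g x
    y≢g x y≡gx = miss (x , sym y≡gx)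
    punchOut∘g-injective : Injective _≡_ _≡_ (λ x → Fin.punchOut (y≢g x))
    punchOut∘g-injective = g-inj ∘ Fin.punchOut-injective (y≢g _) (y≢g _)

least-witness : ∀ {ℓ} {P : Pred ℕ ℓ} → Decidable P →
                ∀ {n} → P n → ∃ λ m → P m × (∀ {j} → j < m → ¬ P j)
least-witness {ℓ} {P} P? {n} = <-rec (λ n → P n → Least) search n
  where
    Least : Set ℓ
    Least = ∃ λ m → P m × (∀ {j} → j < m → ¬ P j)
    search : ∀ n → (∀ {m} → m < n → P m → Least) → P n → Least
    search n below Pn with ℕ.anyUpTo? P? n
    ... | yes (m , m<n , Pm) = below m<n Pm
    ... | no none = n , Pn , λ j<n Pj → none (_ , j<n , Pj)

module _ where

  open import Data.Nat using (_+_; _*_)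

  iter : (A → A) → ℕ → A → A
  iter σ zero    x = x
  iter σ (suc k) x = iter σ k (σ x)

  iter-+ : ∀ i j → iter σ (i + j) x ≡ iter σ j (iter σ i x)
  iter-+ zero    j = refl
  iter-+ (suc i) j = iter-+ i j

  iter-suc : ∀ k → iter σ (suc k) x ≡ σ (iter σ k x)
  iter-suc zero    = refl
  iter-suc (suc k) = iter-suc k

  iter-injective : Injective _≡_ _≡_ σ → ∀ k → iter σ k x ≡ iter σ k y → x ≡ y
  iter-injective σ-inj zero    eq = eq
  iter-injective σ-inj (suc k) eq = σ-inj (iter-injective σ-inj k eq)

  module _ {σ : A → A} {x : A} {d : ℕ} (returns : iter σ (suc d) x ≡ x) where

    iter-*-period : ∀ k → iter σ (k * suc d) x ≡ x
    iter-*-period zero    = refl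
    iter-*-period (suc k) = begin
      iter σ (suc d + k * suc d) x           ≡⟨ iter-+ (suc d) (k * suc d) ⟩
      iter σ (k * suc d) (iter σ (suc d) x)  ≡⟨ cong (iter σ (k * suc d)) returns ⟩
      iter σ (k * suc d) x                   ≡⟨ iter-*-period k ⟩
      x                                      ∎
      where open ≡-Reasoning

    iter-%-period : ∀ k → iter σ k x ≡ iter σ (k % suc d) x
    iter-%-period k = begin
      iter σ k x                       ≡⟨ cong (λ m → iter σ m x) k≡qp+r ⟩
      iter σ (q * suc d + r) x         ≡⟨ iter-+ (q * suc d) r ⟩
      iter σ r (iter σ (q * suc d) x)  ≡⟨ cong (iter σ r) (iter-*-period q) ⟩
      iter σ r x                       ∎
      where
        open ≡-Reasoning
        q r : ℕ
        q = k / suc d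
        r = k % suc d
        k≡qp+r : k ≡ q * suc d + r
        k≡qp+r = trans (m≡m%n+[m/n]*n k (suc d)) (ℕ.+-comm r _)

  Reach : {A : Set a} → (A → A) → A → A → Set a
  Reach σ x y = ∃ λ k → iter σ k x ≡ y

  Reach-refl : Reach σ x x
  Reach-refl = 0 , refl

  Reach-trans : Reach σ x y → Reach σ y z → Reach σ x z
  Reach-trans {x = x} (i , refl) (j , refl) = i + j , iter-+ i j

  Reach-◅ : σ x ≡ y → Reach σ y z → Reach σ x z
  Reach-◅ refl (k , eq) = suc k , eq

  trajectory : (A → A) → ℕ → A → List A
  trajectory σ k x = applyUpTo (λ i → iter σ i x) k

  module _ {σ : A → A} {x : A} {d : ℕ} (returns : iter σ (suc d) x ≡ x) where

    ∈-trajectory⇔Reach : y ∈ trajectory σ (suc d) x ⇔ Reach σ x y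
    ∈-trajectory⇔Reach = mk⇔ to from
      where
        to : y ∈ trajectory σ (suc d) x → Reach σ x y
        to y∈ with i , _ , refl ← ∈-applyUpTo⁻ (λ i → iter σ i x) y∈ = i , refl
        from : Reach σ x y → y ∈ trajectory σ (suc d) x
        from (k , refl) = subst (_∈ trajectory σ (suc d) x) (sym (iter-%-period returns k))
                                (∈-applyUpTo⁺ (λ i → iter σ i x) (m%n<n k (suc d)))

  iter-collision⇒returns : Injective _≡_ _≡_ σ →
                           ∀ i o → iter σ i x ≡ iter σ (suc i + o) x → iter σ (suc o) x ≡ x
  iter-collision⇒returns {σ = σ} {x = x} σ-inj i o eq = sym (iter-injective σ-inj i (begin
    iter σ i x                    ≡⟨ eq ⟩
    iter σ (suc i + o) x          ≡⟨ cong (λ m → iter σ (suc m) x) (ℕ.+-comm i o) ⟩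
    iter σ (suc o + i) x          ≡⟨ iter-+ (suc o) i ⟩
    iter σ i (iter σ (suc o) x)   ∎))
    where open ≡-Reasoning

  trajectory-unique : Injective _≡_ _≡_ σ → (∀ {j} → j < d → iter σ (suc j) x ≢ x) →
                      Unique (trajectory σ (suc d) x)
  trajectory-unique {σ = σ} {d = d} {x = x} σ-inj minimal = applyUpTo⁺₁ _ (suc d) distinct
    where
      distinct : ∀ {i j} → i < j → j < suc d → iter σ i x ≢ iter σ j x
      distinct {i} i<j (s≤s j≤d) eq with o , refl ← ℕ.m≤n⇒∃[o]m+o≡n i<j =
        minimal (ℕ.≤-trans (s≤s (ℕ.m≤n+m o i)) j≤d) (iter-collision⇒returns σ-inj i o eq)

  module FiniteType {a n} {V : Set a} (enum : V ↔ Fin n) where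

    open Inverse enum using (to; from; strictlyInverseʳ)

    elements : List V
    elements = tabulate from

    ∈-elements : ∀ x → x ∈ elements
    ∈-elements x = subst (_∈ elements) (strictlyInverseʳ x) (∈-tabulate⁺ (to x))

    _≟_ : DecidableEquality V
    _≟_ = Fin.inj⇒≟ (↔⇒↣ enum)

    to-injective : Injective _≡_ _≡_ to
    to-injective = Injection.injective (↔⇒↣ enum)

    from-injective : Injective _≡_ _≡_ from
    from-injective = Injection.injective (↔⇒↣ (↔-sym enum))

    endo-injective⇒surjective : {σ : V → V} → Injective _≡_ _≡_ σ → ∀ y → ∃ λ x → σ x ≡ y
    endo-injective⇒surjective σ-inj y
      with i , eq ← injective⇒surjective (from-injective ∘ σ-inj ∘ to-injective) (to y) =
      from i , to-injective eq

    module _ {σ : V → V} (σ-inj : Injective _≡_ _≡_ σ) where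

      period : ∀ x → ∃ λ d → iter σ (suc d) x ≡ x
      period x with Fin.pigeonhole (ℕ.n<1+n n) (λ i → to (iter σ (toℕ i) x))
      ... | i , j , i<j , eq with o , i+1+o≡j ← ℕ.m≤n⇒∃[o]m+o≡n i<j =
        o , iter-collision⇒returns σ-inj (toℕ i) o
              (trans (to-injective eq) (cong (λ m → iter σ m x) (sym i+1+o≡j)))

      minimal-period : ∀ x → ∃ λ d → iter σ (suc d) x ≡ x × (∀ {j} → j < d → iter σ (suc j) x ≢ x)
      minimal-period x with d , returns ← period x =
        least-witness (λ j → iter σ (suc j) x ≟ x) {d} returns

      Reach-sym : Reach σ x y → Reach σ y x
      Reach-sym {x = x} (k , refl) with d , returns ← period x = k * d , (begin
        iter σ (k * d) (iter σ k x)   ≡⟨ iter-+ k (k * d) ⟨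
        iter σ (k + k * d) x          ≡⟨ cong (λ m → iter σ m x) (ℕ.*-suc k d) ⟨
        iter σ (k * suc d) x          ≡⟨ iter-*-period returns k ⟩
        x                             ∎)
        where open ≡-Reasoning

      Reach? : ∀ x y → Dec (Reach σ x y)
      Reach? x y with d , returns ← period x =
        Dec.map (∈-trajectory⇔Reach returns) (y ∈? trajectory σ (suc d) x)
        where open DecMembership _≟_ using (_∈?_)

    transpose : V → V → V → V
    transpose a b u with u ≟ a | u ≟ b
    ... | yes _ | _     = b
    ... | no _  | yes _ = a
    ... | no _  | no _  = u

    module _ {a b : V} where

      transpose-ˡ : transpose a b a ≡ b
      transpose-ˡ with a ≟ a
      ... | yes _  = refl
      ... | no a≢a = contradiction refl a≢a

      transpose-ʳ : transpose a b b ≡ a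
      transpose-ʳ with b ≟ a | b ≟ b
      ... | yes b≡a | _      = b≡a
      ... | no _    | yes _  = refl
      ... | no _    | no b≢b = contradiction refl b≢b

      transpose-other : ∀ {u} → u ≢ a → u ≢ b → transpose a b u ≡ u
      transpose-other {u} u≢a u≢b with u ≟ a | u ≟ b
      ... | yes u≡a | _       = contradiction u≡a u≢a
      ... | no _    | yes u≡b = contradiction u≡b u≢b
      ... | no _    | no _    = refl

      transpose-involutive : ∀ u → transpose a b (transpose a b u) ≡ u
      transpose-involutive u with u ≟ a | u ≟ b
      ... | yes refl | _        = transpose-ʳ
      ... | no _     | yes refl = transpose-ˡ
      ... | no u≢a   | no u≢b   = transpose-other u≢a u≢b

      transpose-injective : Injective _≡_ _≡_ (transpose a b)
      transpose-injective {u} {v} eq =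
        trans (sym (transpose-involutive u)) (trans (cong (transpose a b) eq) (transpose-involutive v))

    module Merge {σ : V → V} (σ-inj : Injective _≡_ _≡_ σ) {a b : V} (a↛b : ¬ Reach σ a b) where

      σ′ : V → V
      σ′ = σ ∘ transpose a b

      σ′-injective : Injective _≡_ _≡_ σ′
      σ′-injective = transpose-injective ∘ σ-inj

      detour : ∀ {t o} → (∀ {w} → w ≢ t → w ≢ o → σ′ w ≡ σ w) →
               ∀ k {w} → ¬ Reach σ w o → iter σ k w ≡ t → Reach σ′ w t
      detour agree zero w↛o refl = Reach-refl
      detour {t} agree (suc k) {w} w↛o σᵏ⁺¹w≡t with w ≟ t
      ... | yes refl = Reach-refl
      ... | no w≢t   = Reach-◅ (agree w≢t (λ w≡o → w↛o (0 , w≡o)))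
                               (detour agree k (w↛o ∘ Reach-◅ refl) σᵏ⁺¹w≡t)

      closes : ∀ {t o} → (∀ {w} → w ≢ t → w ≢ o → σ′ w ≡ σ w) → ¬ Reach σ t o → Reach σ′ (σ t) t
      closes {t} agree t↛o with d , σᵈ⁺¹t≡t ← period σ-inj t =
        detour agree d (t↛o ∘ Reach-◅ refl) σᵈ⁺¹t≡t

      b-closes : Reach σ′ (σ b) b
      b-closes = closes (λ w≢b w≢a → cong σ (transpose-other w≢a w≢b)) (a↛b ∘ Reach-sym σ-inj)

      a-closes : Reach σ′ (σ a) a
      a-closes = closes (λ w≢a w≢b → cong σ (transpose-other w≢a w≢b)) a↛b

      joins : Reach σ′ a b
      joins = Reach-◅ (cong σ transpose-ˡ) b-closes

      σ′-reaches-σ : ∀ u → Reach σ′ u (σ u)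
      σ′-reaches-σ u with u ≟ a | u ≟ b
      ... | yes refl | _        = Reach-trans joins (Reach-◅ (cong σ transpose-ʳ) Reach-refl)
      ... | no _     | yes refl =
        Reach-◅ (cong σ transpose-ʳ) (Reach-trans a-closes (Reach-◅ (cong σ transpose-ˡ) Reach-refl))
      ... | no u≢a   | no u≢b   = Reach-◅ (cong σ (transpose-other u≢a u≢b)) Reach-refl

      σ′-reaches-iter : ∀ k x → Reach σ′ x (iter σ k x)
      σ′-reaches-iter zero    x = Reach-refl
      σ′-reaches-iter (suc k) x = Reach-trans (σ′-reaches-σ x) (σ′-reaches-iter k (σ x))

      extends : Reach σ x y → Reach σ′ x y
      extends {x = x} (k , refl) = σ′-reaches-iter k x

module CycleCovers {a e n} {V : Set a} (enum : V ↔ Fin n) (E : V → V → Set e)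
                   (p : V → V) (p-involutive : ∀ u → p (p u) ≡ u) where

  open FiniteType enum

  Out : (V → V) → V → V → Set a
  Out σ u v = v ≡ σ u ⊎ v ≡ σ (p u)

  record CycleCover : Set (a ⊔ e) where
    field
      π         : V → V
      injective : Injective _≡_ _≡_ π
      out       : ∀ {u v} → E u v ⇔ Out π u v

  transpose-pair : ∀ a u →
    (transpose a (p a) u ≡ u × transpose a (p a) (p u) ≡ p u) ⊎
    (transpose a (p a) u ≡ p u × transpose a (p a) (p u) ≡ u)
  transpose-pair a u = cases (u ≟ a) (u ≟ p a)
    where
      cases : Dec (u ≡ a) → Dec (u ≡ p a) →
        (transpose a (p a) u ≡ u × transpose a (p a) (p u) ≡ p u) ⊎
        (transpose a (p a) u ≡ p u × transpose a (p a) (p u) ≡ u)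
      cases (yes refl) _        = inj₂ (transpose-ˡ , transpose-ʳ)
      cases (no _)     (yes refl) =
        inj₂ ( trans transpose-ʳ (sym (p-involutive a))
             , trans (cong (transpose a (p a)) (p-involutive a)) transpose-ˡ)
      cases (no u≢a)   (no u≢pa)  = inj₁ (transpose-other u≢a u≢pa , transpose-other pu≢a pu≢pa)
        where
          pu≢a : p u ≢ a
          pu≢a pu≡a = u≢pa (trans (sym (p-involutive u)) (cong p pu≡a))
          pu≢pa : p u ≢ p a
          pu≢pa pu≡pa = u≢a (trans (sym (p-involutive u)) (trans (cong p pu≡pa) (p-involutive a)))

  Out-transpose : ∀ {σ} a {u v} → Out (σ ∘ transpose a (p a)) u v ⇔ Out σ u v
  Out-transpose {σ} a {u} {v} with transpose-pair a u
  ... | inj₁ (τu≡u , τpu≡pu) rewrite τu≡u | τpu≡pu = mk⇔ id id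
  ... | inj₂ (τu≡pu , τpu≡u) rewrite τu≡pu | τpu≡u = mk⇔ swap swap

  open CycleCover

  switch : (C : CycleCover) (a : V) → ¬ Reach (π C) a (p a) → CycleCover
  switch C a a↛pa = record
    { π         = σ′
    ; injective = σ′-injective
    ; out       = ⇔-sym (Out-transpose {π C} a) ⇔-∘ out C
    }
    where open Merge (injective C) a↛pa

  linked-cover : CycleCover → (as : List V) → ∃ λ C → ∀ {a} → a ∈ as → Reach (π C) a (p a)
  linked-cover C₀ [] = C₀ , λ ()
  linked-cover C₀ (a ∷ as) with C , linked ← linked-cover C₀ as | Reach? (injective C) a (p a)
  ... | yes a↝pa = C , λ { (here refl) → a↝pa ; (there a′∈as) → linked a′∈as }
  ... | no a↛pa  = switch C a a↛pa , λ { (here refl) → joins ; (there a′∈as) → extends (linked a′∈as) }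
    where open Merge (injective C) a↛pa

  module Linked (C : CycleCover) (linked : ∀ a → Reach (π C) a (p a)) where

    edge-π : ∀ u → E u (π C u)
    edge-π u = Equivalence.from (out C) (inj₁ refl)

    Edge⇒Reach : ∀ {u v} → E u v → Reach (π C) u v
    Edge⇒Reach {u} e with Equivalence.to (out C) e
    ... | inj₁ refl = 1 , refl
    ... | inj₂ refl = Reach-trans (linked u) (1 , refl)

    Star⇒Reach : ∀ {x y} → Star (SymClosure E) x y → Reach (π C) x y
    Star⇒Reach ε             = Reach-refl
    Star⇒Reach (fwd e ◅ path) = Reach-trans (Edge⇒Reach e) (Star⇒Reach path)
    Star⇒Reach (bwd e ◅ path) =
      Reach-trans (Reach-sym (injective C) (Edge⇒Reach e)) (Star⇒Reach path)

    iter⇒Star : ∀ k x → Star (SymClosure E) x (iter (π C) k x)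
    iter⇒Star zero    x = ε
    iter⇒Star (suc k) x = fwd (edge-π x) ◅ iter⇒Star k (π C x)

    Star⇔Reach : ∀ {x y} → Star (SymClosure E) x y ⇔ Reach (π C) x y
    Star⇔Reach {x} = mk⇔ Star⇒Reach λ { (k , refl) → iter⇒Star k x }

module FiniteFieldProperties {c} (F : FiniteField c) where

  open FiniteField F
  open IsCommutativeRing isCommutativeRing
    using (distribˡ; +-comm; *-comm; *-assoc; -‿inverseʳ; *-identityˡ; zeroˡ; zeroʳ)
  open FiniteType enum using (_≟_; to-injective; endo-injective⇒surjective)

  private
    ring : CommutativeRing c c
    ring = record { isCommutativeRing = isCommutativeRing }

  open import Algebra.Properties.Ring (CommutativeRing.ring ring)
    using (-‿distribˡ-*; -‿distribʳ-*; [y-z]x≈yx-zx)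
  open import Algebra.Properties.AbelianGroup (CommutativeRing.+-abelianGroup ring)
    using (⁻¹-involutive; x∙y⁻¹≈ε⇒x≈y)
  open import Algebra.Properties.CommutativeSemigroup (CommutativeRing.*-commutativeSemigroup ring)
    using (interchange)
  open ≡-Reasoning

  x-y≡0⇒x≡y : x + - y ≡ 0# → x ≡ y
  x-y≡0⇒x≡y = x∙y⁻¹≈ε⇒x≈y _ _

  -x*-x≡x*x : ∀ x → (- x) * (- x) ≡ x * x
  -x*-x≡x*x x = begin
    (- x) * (- x)   ≡⟨ -‿distribˡ-* x (- x) ⟨
    - (x * (- x))   ≡⟨ cong -_ (-‿distribʳ-* x x) ⟨
    - (- (x * x))   ≡⟨ ⁻¹-involutive (x * x) ⟩
    x * x           ∎

  *-cancelˡ : x ≢ 0# → x * y ≡ x * z → y ≡ z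
  *-cancelˡ {x} {y} {z} x≢0 xy≡xz with x⁻¹ , xx⁻¹≡1 ← inverse x x≢0 = begin
    y                  ≡⟨ x⁻¹*[x*_]≡id y ⟨
    x⁻¹ * (x * y)      ≡⟨ cong (x⁻¹ *_) xy≡xz ⟩
    x⁻¹ * (x * z)      ≡⟨ x⁻¹*[x*_]≡id z ⟩
    z                  ∎
    where
      x⁻¹*[x*_]≡id : ∀ w → x⁻¹ * (x * w) ≡ w
      x⁻¹*[x*_]≡id w = begin
        x⁻¹ * (x * w)  ≡⟨ *-assoc x⁻¹ x w ⟨
        (x⁻¹ * x) * w  ≡⟨ cong (_* w) (trans (*-comm x⁻¹ x) xx⁻¹≡1) ⟩
        1# * w         ≡⟨ *-identityˡ w ⟩
        w              ∎

  x*-surjective : x ≢ 0# → ∀ z → ∃ λ w → x * w ≡ z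
  x*-surjective {x} x≢0 z with x⁻¹ , xx⁻¹≡1 ← inverse x x≢0 = x⁻¹ * z , (begin
    x * (x⁻¹ * z)   ≡⟨ *-assoc x x⁻¹ z ⟨
    (x * x⁻¹) * z   ≡⟨ cong (_* z) xx⁻¹≡1 ⟩
    1# * z          ≡⟨ *-identityˡ z ⟩
    z               ∎)

  zero-product : x * y ≡ 0# → x ≡ 0# ⊎ y ≡ 0#
  zero-product {x} {y} xy≡0 with x ≟ 0#
  ... | yes x≡0 = inj₁ x≡0
  ... | no x≢0  = inj₂ (*-cancelˡ x≢0 (trans xy≡0 (sym (zeroʳ x))))

  x*x≡0⇒x≡0 : x * x ≡ 0# → x ≡ 0#
  x*x≡0⇒x≡0 xx≡0 with zero-product xx≡0
  ... | inj₁ x≡0 = x≡0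
  ... | inj₂ x≡0 = x≡0

  x*x≡y*y⇒x≡±y : x * x ≡ y * y → x ≡ y ⊎ x ≡ - y
  x*x≡y*y⇒x≡±y {x} {y} xx≡yy with zero-product [x-y][x+y]≡0
    where
      [x-y][x+y]≡0 : (x + - y) * (x + y) ≡ 0#
      [x-y][x+y]≡0 = begin
        (x + - y) * (x + y)                  ≡⟨ [y-z]x≈yx-zx (x + y) x y ⟩
        x * (x + y) + - (y * (x + y))
          ≡⟨ cong₂ (λ s t → s + - t) (distribˡ x x y) (distribˡ y x y) ⟩
        (x * x + x * y) + - (y * x + y * y)
          ≡⟨ cong₂ (λ s t → (s + x * y) + - (t + y * y)) xx≡yy (*-comm y x) ⟩
        (y * y + x * y) + - (x * y + y * y)
          ≡⟨ cong (λ s → (y * y + x * y) + - s) (+-comm (x * y) (y * y)) ⟩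
        (y * y + x * y) + - (y * y + x * y)  ≡⟨ -‿inverseʳ _ ⟩
        0#                                   ∎
  ... | inj₁ x-y≡0 = inj₁ (x-y≡0⇒x≡y x-y≡0)
  ... | inj₂ x+y≡0 = inj₂ (x-y≡0⇒x≡y (trans (cong (x +_) (⁻¹-involutive y)) x+y≡0))

  [x-z][y-z]≡0⇔ : (x + - z) * (y + - z) ≡ 0# ⇔ (x ≡ z ⊎ y ≡ z)
  [x-z][y-z]≡0⇔ {x} {z} {y} = mk⇔ to from
    where
      to : (x + - z) * (y + - z) ≡ 0# → x ≡ z ⊎ y ≡ z
      to eq with zero-product eq
      ... | inj₁ x-z≡0 = inj₁ (x-y≡0⇒x≡y x-z≡0)
      ... | inj₂ y-z≡0 = inj₂ (x-y≡0⇒x≡y y-z≡0)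
      from : x ≡ z ⊎ y ≡ z → (x + - z) * (y + - z) ≡ 0#
      from (inj₁ refl) = trans (cong (_* (y + - z)) (-‿inverseʳ x)) (zeroˡ _)
      from (inj₂ refl) = trans (cong ((x + - z) *_) (-‿inverseʳ y)) (zeroʳ _)

  module TwistedSquares {λ' : Carrier} (λ-nonsquare : NonSquare F λ') where

    λ≢0 : λ' ≢ 0#
    λ≢0 λ≡0 = λ-nonsquare (0# , trans (zeroˡ 0#) (sym λ≡0))

    λ*x*x≡y*y⇒x≡0 : λ' * (x * x) ≡ y * y → x ≡ 0#
    λ*x*x≡y*y⇒x≡0 {x} {y} λxx≡yy with x ≟ 0#
    ... | yes x≡0 = x≡0
    ... | no x≢0 with w , xw≡y ← x*-surjective x≢0 y =
      contradiction (w , sym (*-cancelˡ xx≢0 xxλ≡xxww)) λ-nonsquare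
      where
        xx≢0 : x * x ≢ 0#
        xx≢0 = x≢0 ∘ x*x≡0⇒x≡0
        xxλ≡xxww : (x * x) * λ' ≡ (x * x) * (w * w)
        xxλ≡xxww = begin
          (x * x) * λ'          ≡⟨ *-comm (x * x) λ' ⟩
          λ' * (x * x)          ≡⟨ λxx≡yy ⟩
          y * y                 ≡⟨ cong₂ _*_ xw≡y xw≡y ⟨
          (x * w) * (x * w)     ≡⟨ interchange x w x w ⟩
          (x * x) * (w * w)     ∎

    λ*x*x≡y*y⇒x≡0×y≡0 : λ' * (x * x) ≡ y * y → x ≡ 0# × y ≡ 0#
    λ*x*x≡y*y⇒x≡0×y≡0 {x} {y} λxx≡yy with refl ← λ*x*x≡y*y⇒x≡0 λxx≡yy = refl , x*x≡0⇒x≡0 (begin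
      y * y              ≡⟨ λxx≡yy ⟨
      λ' * (0# * 0#)     ≡⟨ cong (λ' *_) (zeroˡ 0#) ⟩
      λ' * 0#            ≡⟨ zeroʳ λ' ⟩
      0#                 ∎)

    Root : Carrier → Carrier → Set c
    Root s v = v * v ≡ s ⊎ λ' * (v * v) ≡ s

    Root-neg : ∀ {s v} → Root s v → Root s (- v)
    Root-neg {s} {v} = subst (λ t → t ≡ s ⊎ λ' * t ≡ s) (sym (-x*-x≡x*x v))

    open Inverse enum using () renaming (to to index)

    -- Any choice of which of y, −y gets squared (the other being squared and scaled by λ)
    -- yields a bijection; the enumeration order makes the choice.
    twistedSquare : Carrier → Carrier
    twistedSquare y with index y Fin.≤? index (- y)
    ... | yes _ = y * y
    ... | no _  = λ' * (y * y)

    Root-twistedSquare-self : ∀ w → Root (twistedSquare w) w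
    Root-twistedSquare-self w with index w Fin.≤? index (- w)
    ... | yes _ = inj₁ refl
    ... | no _  = inj₂ refl

    Root-twistedSquare : ∀ {w v} → Root (twistedSquare w) v ⇔ (v ≡ w ⊎ v ≡ - w)
    Root-twistedSquare {w} {v} = mk⇔ roots λ
      { (inj₁ refl) → Root-twistedSquare-self w
      ; (inj₂ refl) → Root-neg (Root-twistedSquare-self w)
      }
      where
        roots : Root (twistedSquare w) v → v ≡ w ⊎ v ≡ - w
        roots with index w Fin.≤? index (- w)
        ... | yes _ = λ
          { (inj₁ vv≡ww)  → x*x≡y*y⇒x≡±y vv≡ww
          ; (inj₂ λvv≡ww) → let v≡0 , w≡0 = λ*x*x≡y*y⇒x≡0×y≡0 λvv≡ww
                             in inj₁ (trans v≡0 (sym w≡0))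
          }
        ... | no _ = λ
          { (inj₁ vv≡λww)  → let w≡0 , v≡0 = λ*x*x≡y*y⇒x≡0×y≡0 (sym vv≡λww)
                              in inj₁ (trans v≡0 (sym w≡0))
          ; (inj₂ λvv≡λww) → x*x≡y*y⇒x≡±y (*-cancelˡ λ≢0 λvv≡λww)
          }

    twistedSquare-neg : twistedSquare (- z) ≡ twistedSquare z → - z ≡ z
    twistedSquare-neg {z} eq with index z Fin.≤? index (- z) | index (- z) Fin.≤? index (- (- z))
    ... | yes z≤-z | yes -z≤--z =
      to-injective (Fin.≤-antisym (subst (λ t → index (- z) Fin.≤ index t) (⁻¹-involutive z) -z≤--z) z≤-z)
    ... | yes _    | no _       = let -z≡0 , z≡0 = λ*x*x≡y*y⇒x≡0×y≡0 eq in trans -z≡0 (sym z≡0)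
    ... | no _     | yes _      = let z≡0 , -z≡0 = λ*x*x≡y*y⇒x≡0×y≡0 (sym eq) in trans -z≡0 (sym z≡0)
    ... | no z≰-z  | no -z≰--z  =
      contradiction (ℕ.≰⇒> z≰-z) (Fin.<-asym (subst (λ t → index t Fin.< index (- z)) (⁻¹-involutive z) (ℕ.≰⇒> -z≰--z)))

    twistedSquare-injective : Injective _≡_ _≡_ twistedSquare
    twistedSquare-injective {y} {z} eq
      with Equivalence.to Root-twistedSquare (subst (λ s → Root s y) eq (Root-twistedSquare-self y))
    ... | inj₁ y≡z  = y≡z
    ... | inj₂ refl = twistedSquare-neg eq

    twistedSquare-surjective : ∀ s → ∃ λ w → twistedSquare w ≡ s
    twistedSquare-surjective = endo-injective⇒surjective twistedSquare-injective

    Edge⇔Root : ∀ {f u v} → Edge F λ' f u v ⇔ Root (eval F f u) v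
    Edge⇔Root = [x-z][y-z]≡0⇔

    module PermutationGraph (f : Poly F) (f-perm : IsPermutationPoly F f) where

      σ₀ : Carrier → Carrier
      σ₀ u = proj₁ (twistedSquare-surjective (eval F f u))

      twistedSquare-σ₀ : ∀ u → twistedSquare (σ₀ u) ≡ eval F f u
      twistedSquare-σ₀ u = proj₂ (twistedSquare-surjective (eval F f u))

      σ₀-injective : Injective _≡_ _≡_ σ₀
      σ₀-injective {u} {w} eq =
        proj₁ f-perm u w (trans (sym (twistedSquare-σ₀ u)) (trans (cong twistedSquare eq) (twistedSquare-σ₀ w)))

      -- u and p u are the two vertices whose out-neighbours are ±σ₀ u.
      p : Carrier → Carrier
      p u = proj₁ (proj₂ f-perm (twistedSquare (- σ₀ u)))

      σ₀-p : ∀ u → σ₀ (p u) ≡ - σ₀ u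
      σ₀-p u = twistedSquare-injective (trans (twistedSquare-σ₀ (p u)) (proj₂ (proj₂ f-perm _)))

      p-involutive : ∀ u → p (p u) ≡ u
      p-involutive u = σ₀-injective (begin
        σ₀ (p (p u))  ≡⟨ σ₀-p (p u) ⟩
        - σ₀ (p u)    ≡⟨ cong -_ (σ₀-p u) ⟩
        - - σ₀ u      ≡⟨ ⁻¹-involutive (σ₀ u) ⟩
        σ₀ u          ∎)

      open CycleCovers enum (Edge F λ' f) p p-involutive using (CycleCover; Out)

      Edge⇔Out : ∀ {u v} → Edge F λ' f u v ⇔ Out σ₀ u v
      Edge⇔Out {u} {v} =
        subst (λ t → Edge F λ' f u v ⇔ (v ≡ σ₀ u ⊎ v ≡ t)) (sym (σ₀-p u))
          (subst (λ s → Root s v ⇔ (v ≡ σ₀ u ⊎ v ≡ - σ₀ u)) (twistedSquare-σ₀ u) Root-twistedSquare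
            ⇔-∘ Edge⇔Root {f})

      cover : CycleCover
      cover = record { π = σ₀ ; injective = σ₀-injective ; out = Edge⇔Out }

module Hamiltonicity {c} {F : FiniteField c} {λ' : FiniteField.Carrier F} {f : Poly F} where

  open FiniteField F using (Carrier; enum)

  trajectory-CycleEdges : {σ : Carrier → Carrier} → (∀ u → Edge F λ' f u (σ u)) →
    ∀ k {x first} → Edge F λ' f (iter σ k x) first → CycleEdges F λ' f first (trajectory σ (suc k) x)
  trajectory-CycleEdges edge zero    last = last
  trajectory-CycleEdges edge (suc k) last = edge _ , trajectory-CycleEdges edge k last

  module _ {p : Carrier → Carrier} {p-involutive : ∀ u → p (p u) ≡ u} where

    open CycleCovers enum (Edge F λ' f) p p-involutive
    open FiniteType enum using (minimal-period; elements; ∈-elements)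
    open CycleCover

    linked-cover⇒hamiltonian : (C : CycleCover) → (∀ a → Reach (π C) a (p a)) →
                               ∀ x → ComponentHasHamiltonianCycle F λ' f x
    linked-cover⇒hamiltonian C linked x with m , returns , minimal ← minimal-period (injective C) x =
      trajectory (π C) (suc m) x ,
      (trajectory-unique (injective C) minimal , trajectory-CycleEdges edge-π m closing) ,
      λ y → ( from Star⇔Reach ∘ to (∈-trajectory⇔Reach returns)
            , from (∈-trajectory⇔Reach returns) ∘ to Star⇔Reach )
      where
        open Linked C linked
        open Equivalence
        closing : Edge F λ' f (iter (π C) m x) x
        closing = subst (Edge F λ' f (iter (π C) m x)) (trans (sym (iter-suc m)) returns) (edge-π _)

    cover⇒hamiltonian : CycleCover → ∀ x → ComponentHasHamiltonianCycle F λ' f x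
    cover⇒hamiltonian C₀ with C , linked ← linked-cover C₀ elements =
      linked-cover⇒hamiltonian C (λ a → linked (∈-elements a))

theorem2p4 : {c : Level} (F : FiniteField c) → OddCharacteristic F →
    (λ' : FiniteField.Carrier F) → NonSquare F λ' →
    (f : Poly F) → IsPermutationPoly F f →
    ∀ x → ComponentHasHamiltonianCycle F λ' f x
theorem2p4 F _ λ' λ-nonsquare f f-perm = cover⇒hamiltonian cover
  where
    open FiniteFieldProperties F
    open TwistedSquares λ-nonsquare
    open PermutationGraph f f-perm
    open Hamiltonicity
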